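{- Let $T$ be a finite rooted ordered tree with root $r$ and let $v\in T\setminus\{r\}$. Then the parent of $v$ in the dual tree $T^*$ is $$\mathsf{pa}^*(v)=\begin{cases}\min R[v] & \text{if } R[v]\ne\emptyset,\\ r & \text{if } R[v]=\emptyset,\end{cases}$$ where the minimum is with respect to depth-first traversal order of $T$.
   Context: Depth-first traversal order $<$ on $T$ is preorder. $T[v]$ is the set of $v$ and its descendants in $T$, and $R[v]:=\{u\in T\setminus T[v]\mid v<u\}$. The dual $T^*$ has the same vertex set and root $r$, with parent function $\mathsf{pa}^*$; with $rmc_T(u)$ the rightmost child and $ils_T(u)$ the immediate left sibling of $u$ in $T$: (1a) $r$ has no parent in $T^*$; (1b) if $v=rmc_T(r)$ then $v$ is the rightmost child of $r$ in $T^*$; (2) if $v=rmc_T(u)$ with $u\ne r$, then $v$ is the immediate left sibling of $u$ in $T^*$, so $\mathsf{pa}^*(v)=\mathsf{pa}^*(u)$; (3) if $v=ils_T(u)$, then $v$ is the rightmost child of $u$ in $T^*$, so $\mathsf{pa}^*(v)=u$. -}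

module Defs where

open import Data.Nat using (ℕ; zero; suc; _<ᵇ_)
open import Data.Bool using (Bool; true; false; if_then_else_)
open import Data.List using (List; []; _∷_; _++_; map; length; reverse; [_])
open import Data.Maybe using (Maybe; just; nothing)
open import Data.Product using (Σ; ∃; _×_)
open import Data.Sum using (_⊎_)
open import Relation.Nullary using (¬_)
open import Relation.Binary.PropositionalEquality using (_≡_)
open import Data.List.Membership.Propositional using (_∈_)

data Tree : Set where
  node : List Tree → Tree

-- A vertex is addressed by its path from the root: the list of child indices
-- (0 = leftmost child).  The root r is the empty path [].
Pos : Set
Pos = List ℕ

-- Vertices of T listed in depth-first traversal order (preorder).
mutual
  positions : Tree → List Pos
  positions (node ts) = [] ∷ positionsF 0 ts

  positionsF : ℕ → List Tree → List Pos
  positionsF i [] = []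
  positionsF i (t ∷ ts) = map (i ∷_) (positions t) ++ positionsF (suc i) ts

Vertex : Tree → Pos → Set
Vertex T v = v ∈ positions T

_≺[_]_ : Pos → Tree → Pos → Set
u ≺[ T ] v = ∃ λ xs → ∃ λ ys → ∃ λ zs → positions T ≡ xs ++ (u ∷ ys ++ (v ∷ zs))

InSubtree : Pos → Pos → Set
InSubtree v u = ∃ λ w → v ++ w ≡ u

-- u ∈ R[v] = { u ∈ T \ T[v] | v < u }.
InR : Tree → Pos → Pos → Set
InR T v u = Vertex T u × (¬ InSubtree v u) × (v ≺[ T ] u)

IsMinR : Tree → Pos → Pos → Set
IsMinR T v m = InR T v m × (∀ u → InR T v u → m ≡ u ⊎ m ≺[ T ] u)

lookupℕ : List Tree → ℕ → Maybe Tree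
lookupℕ [] i = nothing
lookupℕ (t ∷ ts) zero = just t
lookupℕ (t ∷ ts) (suc i) = lookupℕ ts i

subtree : Tree → Pos → Maybe Tree
subtree t [] = just t
subtree (node ts) (i ∷ p) with lookupℕ ts i
... | nothing = nothing
... | just t = subtree t p

hasChild : Tree → Pos → ℕ → Bool
hasChild T p i with subtree T p
... | nothing = false
... | just (node ts) = i <ᵇ length ts

-- Argument: the path of a non-root vertex v, in REVERSED order (last index first).
-- Write v = p·i (p its parent in T).
--  * if p·(i+1) exists, then v = ils_T(p·(i+1)), so pa*(v) = p·(i+1)      (rule 3)
--  * otherwise v = rmc_T(p):
--      - if p = r then pa*(v) = r                                           (rule 1b)
--      - else pa*(v) = pa*(p)                                               (rule 2)
paStarRev : Tree → List ℕ → Pos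
paStarRev T [] = []   -- root: no dual parent (rule 1a); value irrelevant
paStarRev T (i ∷ rp) =
  if hasChild T (reverse rp) (suc i)
  then reverse rp ++ [ suc i ]
  else paStarRev T rp

paStar : Tree → Pos → Pos
paStar T v = paStarRev T (reverse v)

-- In the preorder listing of T the subtree T[v] occupies a contiguous block
-- starting at v, and everything before or after the block lies outside T[v].
-- Hence R[v] is exactly the part of the listing after the block, and min R[v]
-- is its first element.  The recursion defining pa* computes that element:
-- the block of v = p·i is followed by the block of its right sibling p·(i+1)
-- if there is one, and otherwise by whatever follows the block of p (nothing
-- when p = r).
module Submission where

open import Defs
open import Data.Empty using (⊥-elim)
open import Data.List using (List; []; _∷_; _++_; map; length; reverse; [_]; head)
open import Data.List.Membership.Propositional using (_∈_; _∉_)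
open import Data.List.Membership.Propositional.Properties
  using (∈-∃++; ∈-insert; ∈-++⁻; ∈-++⁺ʳ; ∈-map⁻)
open import Data.List.Properties
  using (∷-injectiveˡ; ∷-injectiveʳ; ++-assoc; ++-identityʳ; ++-identityʳ-unique; ++-cancelˡ;
         map-++; map-∘; map-cong; map-id; unfold-reverse; reverse-involutive)
open import Data.List.Relation.Unary.All as All using (All; []; _∷_)
import Data.List.Relation.Unary.All.Properties as All
open import Data.List.Relation.Unary.Any using (here; there)
open import Data.List.Relation.Unary.Any.Properties using (¬Any[])
open import Data.Maybe using (just; fromMaybe)
open import Data.Nat using (ℕ; zero; suc; _+_; _≤_; _<_; _<ᵇ_; s≤s)
open import Data.Nat.Properties using (+-suc; +-identityʳ; ≤-refl; <⇒≤; <⇒≢; >⇒≢; m≤m+n)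
open import Data.Product using (Σ; ∃; ∃₂; _×_; _,_)
open import Data.Sum using (_⊎_; inj₁; inj₂)
open import Relation.Nullary using (¬_)
open import Relation.Binary.PropositionalEquality
  using (_≡_; _≢_; refl; sym; trans; cong; subst; module ≡-Reasoning)

private
  variable
    A : Set
    a b : A
    ys : List A

Precedes : List A → A → A → Set
Precedes xs a b = ∃ λ ys → ∃ λ zs → ∃ λ ws → xs ≡ ys ++ (a ∷ zs ++ (b ∷ ws))

∈⇒Precedes : ∀ xs → b ∈ ys → Precedes (xs ++ a ∷ ys) a b
∈⇒Precedes xs b∈ys with ∈-∃++ b∈ys
... | zs , ws , refl = xs , zs , ws , refl

∷-suffix-unique : ∀ xs ys {xs′ ys′} → a ∉ xs → a ∉ ys →
  xs ++ a ∷ ys ≡ xs′ ++ a ∷ ys′ → ys ≡ ys′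
∷-suffix-unique []       ys {[]}      _    _    eq = ∷-injectiveʳ eq
∷-suffix-unique []       ys {_ ∷ xs′} _    a∉ys eq =
  ⊥-elim (a∉ys (subst (_ ∈_) (sym (∷-injectiveʳ eq)) (∈-insert xs′)))
∷-suffix-unique (x ∷ xs) ys {[]}      a∉xs _    eq = ⊥-elim (a∉xs (here (sym (∷-injectiveˡ eq))))
∷-suffix-unique (x ∷ xs) ys {_ ∷ xs′} a∉xs a∉ys eq =
  ∷-suffix-unique xs ys (λ a∈xs → a∉xs (there a∈xs)) a∉ys (∷-injectiveʳ eq)

Precedes⇒∈ : ∀ xs → a ∉ xs → a ∉ ys → Precedes (xs ++ a ∷ ys) a b → b ∈ ys
Precedes⇒∈ xs a∉xs a∉ys (xs′ , zs , ws , eq)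
  rewrite ∷-suffix-unique xs _ a∉xs a∉ys eq = ∈-insert zs

∷-++≢ : ∀ (p : Pos) {j q} → p ++ j ∷ q ≢ p
∷-++≢ p eq with ++-identityʳ-unique p (sym eq)
... | ()

InSubtree-refl : ∀ v → InSubtree v v
InSubtree-refl v = [] , ++-identityʳ v

InSubtree-trans : ∀ {u v w} → InSubtree u v → InSubtree v w → InSubtree u w
InSubtree-trans {u} (x , refl) (y , refl) = x ++ y , sym (++-assoc u x y)

¬InSubtree-child-parent : ∀ p i → ¬ InSubtree (p ++ [ i ]) p
¬InSubtree-child-parent p i (w , eq) = ∷-++≢ p (trans (sym (++-assoc p [ i ] w)) eq)

¬InSubtree-sibling : ∀ p {i j q} → j ≢ i → ¬ InSubtree (p ++ [ i ]) (p ++ j ∷ q)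
¬InSubtree-sibling p j≢i (w , eq) with ++-cancelˡ p _ _ (trans (sym (++-assoc p [ _ ] w)) eq)
... | refl = j≢i refl

positionsF-++ : ∀ k xs ys →
  positionsF k (xs ++ ys) ≡ positionsF k xs ++ positionsF (k + length xs) ys
positionsF-++ k []       ys rewrite +-identityʳ k = refl
positionsF-++ k (t ∷ xs) ys rewrite positionsF-++ (suc k) xs ys | +-suc k (length xs) =
  sym (++-assoc (map (k ∷_) (positions t)) (positionsF (suc k) xs) _)

HeadBetween : ℕ → ℕ → Pos → Set
HeadBetween k n x = ∃₂ λ j q → x ≡ j ∷ q × k ≤ j × j < n

positionsF-heads : ∀ k ts → All (HeadBetween k (k + length ts)) (positionsF k ts)
positionsF-heads k []       = []
positionsF-heads k (t ∷ ts) =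
  All.++⁺ (All.map⁺ (All.universal (λ q → k , q , refl , ≤-refl , k<k+suc) (positions t)))
          (All.map shift (positionsF-heads (suc k) ts))
  where
  k<k+suc : k < k + suc (length ts)
  k<k+suc rewrite +-suc k (length ts) = s≤s (m≤m+n k (length ts))
  shift : ∀ {x} → HeadBetween (suc k) (suc k + length ts) x → HeadBetween k (k + suc (length ts)) x
  shift (j , q , eq , k<j , j<n) rewrite +-suc k (length ts) = j , q , eq , <⇒≤ k<j , j<n

∉-descendants : ∀ v ts → v ∉ map (v ++_) (positionsF 0 ts)
∉-descendants v ts v∈ with ∈-map⁻ (v ++_) v∈
... | x , x∈ , eq with All.lookup (positionsF-heads 0 ts) x∈
...   | _ , _ , refl , _ = ∷-++≢ v (sym eq)

map-++-map-∷ : ∀ (p : Pos) i (xs : List Pos) → map (p ++_) (map (i ∷_) xs) ≡ map ((p ++ [ i ]) ++_) xs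
map-++-map-∷ p i xs = trans (sym (map-∘ xs)) (map-cong (λ x → sym (++-assoc p [ i ] x)) xs)

lookupℕ-split : ∀ ts i {t} → lookupℕ ts i ≡ just t → ∃₂ λ xs ys → ts ≡ xs ++ t ∷ ys × length xs ≡ i
lookupℕ-split (t ∷ ts) zero    refl = [] , ts , refl , refl
lookupℕ-split (u ∷ ts) (suc i) eq with lookupℕ-split ts i eq
... | xs , ys , refl , refl = u ∷ xs , ys , refl , refl

subtree-∷ : ∀ ts j p {t} → lookupℕ ts j ≡ just t → subtree (node ts) (j ∷ p) ≡ subtree t p
subtree-∷ ts j p eq rewrite eq = refl

subtree-∷ʳ : ∀ T p i {t} → subtree T (p ++ [ i ]) ≡ just t →
  ∃ λ ts → subtree T p ≡ just (node ts) × lookupℕ ts i ≡ just t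
subtree-∷ʳ (node ts) [] i eq with lookupℕ ts i in lookup-i
subtree-∷ʳ (node ts) [] i refl | just t = ts , refl , lookup-i
subtree-∷ʳ (node ts) (j ∷ p) i eq with lookupℕ ts j
... | just t = subtree-∷ʳ t p i eq

mutual
  subtree-vertex : ∀ T {v} → Vertex T v → ∃ λ ts → subtree T v ≡ just (node ts)
  subtree-vertex (node ts) (here refl) = ts , refl
  subtree-vertex (node ts) (there v∈) with subtreeF-vertex 0 ts v∈
  ... | j , p , refl , t , eq , cs , st = cs , trans (subtree-∷ ts j p eq) st

  subtreeF-vertex : ∀ k ts {v} → v ∈ positionsF k ts →
    ∃₂ λ j p → v ≡ (k + j) ∷ p × ∃ λ t → lookupℕ ts j ≡ just t × ∃ λ cs → subtree t p ≡ just (node cs)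
  subtreeF-vertex k (t ∷ ts) v∈ with ∈-++⁻ (map (k ∷_) (positions t)) v∈
  ... | inj₁ v∈t with ∈-map⁻ (k ∷_) v∈t
  ...   | p , p∈ , refl = 0 , p , cong (_∷ p) (sym (+-identityʳ k)) , t , refl , subtree-vertex t p∈
  subtreeF-vertex k (t ∷ ts) v∈ | inj₂ v∈ts with subtreeF-vertex (suc k) ts v∈ts
  ... | j , p , refl , rest = suc j , p , cong (_∷ p) (sym (+-suc k j)) , rest

suc-length-<ᵇ : ∀ (xs : List A) t ys → (suc (length xs) <ᵇ length (xs ++ t ∷ ys)) ≡ (0 <ᵇ length ys)
suc-length-<ᵇ []       t ys = refl
suc-length-<ᵇ (_ ∷ xs) t ys = suc-length-<ᵇ xs t ys

hasChild-subtree : ∀ T p {ts} n → subtree T p ≡ just (node ts) → hasChild T p n ≡ (n <ᵇ length ts)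
hasChild-subtree T p n eq with subtree T p
hasChild-subtree T p n refl | just _ = refl

paStarRev-∷ : ∀ T rv xs {t} ys → subtree T (reverse rv) ≡ just (node (xs ++ t ∷ ys)) →
  paStarRev T (length xs ∷ rv)
    ≡ fromMaybe (paStarRev T rv) (head (map (reverse rv ++_) (positionsF (suc (length xs)) ys)))
paStarRev-∷ T rv xs {t} ys st
  rewrite hasChild-subtree T (reverse rv) (suc (length xs)) st | suc-length-<ᵇ xs t ys with ys
... | []           = refl
... | node _ ∷ _   = refl

fromMaybe-head-++ : ∀ (d : A) xs ys →
  fromMaybe (fromMaybe d (head ys)) (head xs) ≡ fromMaybe d (head (xs ++ ys))
fromMaybe-head-++ d []       ys = refl
fromMaybe-head-++ d (x ∷ xs) ys = refl

Outside : Pos → Pos → Set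
Outside v u = ¬ InSubtree v u

record Split (T : Tree) (v : Pos) (cs : List Tree) : Set where
  constructor split
  field
    before after     : List Pos
    positions≡       : positions T ≡ before ++ v ∷ map (v ++_) (positionsF 0 cs) ++ after
    before-outside   : All (Outside v) before
    after-outside    : All (Outside v) after

open Split

Split-root : ∀ cs → Split (node cs) [] cs
Split-root cs = split [] [] (cong ([] ∷_) (sym (trans (++-identityʳ _) (map-id _)))) [] []

Split-child : ∀ {T p xs cs ys} (s : Split T p (xs ++ node cs ∷ ys)) →
  Σ (Split T (p ++ [ length xs ]) cs) λ s′ →
    after s′ ≡ map (p ++_) (positionsF (suc (length xs)) ys) ++ after s
Split-child {T} {p} {xs} {cs} {ys} (split A B eq outA outB) =
  split (A ++ p ∷ MX) (MY ++ B) positions≡′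
    (All.++⁺ (All.map narrow outA)
             (¬InSubtree-child-parent p i ∷ All.map⁺ (All.map before-i (positionsF-heads 0 xs))))
    (All.++⁺ (All.map⁺ (All.map after-i (positionsF-heads (suc i) ys)))
             (All.map narrow outB)) ,
  refl
  where
  i = length xs
  c = p ++ [ i ]
  MX = map (p ++_) (positionsF 0 xs)
  MD = map (c ++_) (positionsF 0 cs)
  MY = map (p ++_) (positionsF (suc i) ys)

  narrow : ∀ {u} → Outside p u → Outside c u
  narrow out u∈ = out (InSubtree-trans ([ i ] , refl) u∈)

  before-i : ∀ {x} → HeadBetween 0 i x → Outside c (p ++ x)
  before-i (j , q , refl , _ , j<i) = ¬InSubtree-sibling p (<⇒≢ j<i)

  after-i : ∀ {x} → HeadBetween (suc i) (suc i + length ys) x → Outside c (p ++ x)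
  after-i (j , q , refl , i<j , _) = ¬InSubtree-sibling p (>⇒≢ i<j)

  children≡ : map (p ++_) (positionsF 0 (xs ++ node cs ∷ ys)) ≡ MX ++ c ∷ MD ++ MY
  children≡ = begin
    map (p ++_) (positionsF 0 (xs ++ node cs ∷ ys))
      ≡⟨ cong (map (p ++_)) (positionsF-++ 0 xs (node cs ∷ ys)) ⟩
    map (p ++_) (positionsF 0 xs ++ (i ∷ []) ∷ map (i ∷_) (positionsF 0 cs) ++ positionsF (suc i) ys)
      ≡⟨ map-++ (p ++_) (positionsF 0 xs) _ ⟩
    MX ++ c ∷ map (p ++_) (map (i ∷_) (positionsF 0 cs) ++ positionsF (suc i) ys)
      ≡⟨ cong (λ z → MX ++ c ∷ z) (map-++ (p ++_) (map (i ∷_) (positionsF 0 cs)) _) ⟩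
    MX ++ c ∷ map (p ++_) (map (i ∷_) (positionsF 0 cs)) ++ MY
      ≡⟨ cong (λ z → MX ++ c ∷ z ++ MY) (map-++-map-∷ p i (positionsF 0 cs)) ⟩
    MX ++ c ∷ MD ++ MY ∎
    where open ≡-Reasoning

  positions≡′ : positions T ≡ (A ++ p ∷ MX) ++ c ∷ MD ++ MY ++ B
  positions≡′ = begin
    positions T
      ≡⟨ eq ⟩
    A ++ p ∷ map (p ++_) (positionsF 0 (xs ++ node cs ∷ ys)) ++ B
      ≡⟨ cong (λ z → A ++ p ∷ z ++ B) children≡ ⟩
    A ++ p ∷ (MX ++ c ∷ MD ++ MY) ++ B
      ≡⟨ cong (λ z → A ++ p ∷ z) (++-assoc MX (c ∷ MD ++ MY) B) ⟩
    A ++ p ∷ MX ++ c ∷ (MD ++ MY) ++ B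
      ≡⟨ cong (λ z → A ++ p ∷ MX ++ c ∷ z) (++-assoc MD MY B) ⟩
    A ++ p ∷ MX ++ c ∷ MD ++ MY ++ B
      ≡⟨ sym (++-assoc A (p ∷ MX) _) ⟩
    (A ++ p ∷ MX) ++ c ∷ MD ++ MY ++ B ∎
    where open ≡-Reasoning

Split-paStarRev : ∀ T rv v {cs} → v ≡ reverse rv → subtree T v ≡ just (node cs) →
  Σ (Split T v cs) λ s → paStarRev T rv ≡ fromMaybe [] (head (after s))
Split-paStarRev (node ts) []       .[] refl refl = Split-root ts , refl
Split-paStarRev T         (i ∷ rv) v   v≡ st rewrite trans v≡ (unfold-reverse i rv)
  with subtree-∷ʳ T (reverse rv) i st
... | ts , st-p , lookup-i with lookupℕ-split ts i lookup-i
... | xs , ys , refl , refl with Split-paStarRev T rv (reverse rv) refl st-p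
... | s , paStar-p with Split-child {xs = xs} {ys = ys} s
... | s′ , after≡ = s′ , (begin
  paStarRev T (length xs ∷ rv)
    ≡⟨ paStarRev-∷ T rv xs ys st-p ⟩
  fromMaybe (paStarRev T rv) (head M)
    ≡⟨ cong (λ d → fromMaybe d (head M)) paStar-p ⟩
  fromMaybe (fromMaybe [] (head (after s))) (head M)
    ≡⟨ fromMaybe-head-++ [] M (after s) ⟩
  fromMaybe [] (head (M ++ after s))
    ≡⟨ cong (λ z → fromMaybe [] (head z)) (sym after≡) ⟩
  fromMaybe [] (head (after s′)) ∎)
  where
  open ≡-Reasoning
  M = map (reverse rv ++_) (positionsF (suc (length xs)) ys)

module _ {T v cs} (s : Split T v cs) where

  private
    D = map (v ++_) (positionsF 0 cs)

    v∉before : v ∉ before s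
    v∉before v∈ = All.lookup (before-outside s) v∈ (InSubtree-refl v)

    v∉rest : v ∉ D ++ after s
    v∉rest v∈ with ∈-++⁻ D v∈
    ... | inj₁ v∈D = ∉-descendants v cs v∈D
    ... | inj₂ v∈after = All.lookup (after-outside s) v∈after (InSubtree-refl v)

    ≺⇒∈rest : ∀ {u} → v ≺[ T ] u → u ∈ D ++ after s
    ≺⇒∈rest v≺u = Precedes⇒∈ (before s) v∉before v∉rest (subst (λ xs → Precedes xs v _) (positions≡ s) v≺u)

  InR⇒∈after : ∀ {u} → InR T v u → u ∈ after s
  InR⇒∈after (_ , out , v≺u) with ∈-++⁻ D (≺⇒∈rest v≺u)
  ... | inj₁ u∈D with ∈-map⁻ (v ++_) u∈D
  ...   | w , _ , refl = ⊥-elim (out (w , refl))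
  InR⇒∈after (_ , out , v≺u) | inj₂ u∈after = u∈after

  ∈after⇒InR : ∀ {u} → u ∈ after s → InR T v u
  ∈after⇒InR u∈ =
    subst (_ ∈_) (sym (positions≡ s)) (∈-++⁺ʳ (before s) (there (∈-++⁺ʳ D u∈))) ,
    All.lookup (after-outside s) u∈ ,
    subst (λ xs → Precedes xs v _) (sym (positions≡ s)) (∈⇒Precedes (before s) (∈-++⁺ʳ D u∈))

MinROrRoot : Tree → Pos → Pos → Set
MinROrRoot T v q = ((∃ λ u → InR T v u) → IsMinR T v q) × ((¬ (∃ λ u → InR T v u)) → q ≡ [])

Split⇒MinROrRoot : ∀ {T v cs} (s : Split T v cs) → MinROrRoot T v (fromMaybe [] (head (after s)))
Split⇒MinROrRoot s@(split _ [] _ _ _) = (λ (u , u∈R) → ⊥-elim (¬Any[] (InR⇒∈after s u∈R))) , λ _ → refl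
Split⇒MinROrRoot {T} {v} {cs} s@(split A (q ∷ B) eq _ _) =
  (λ _ → ∈after⇒InR s (here refl) , minimal) , λ ¬R → ⊥-elim (¬R (q , ∈after⇒InR s (here refl)))
  where
  minimal : ∀ u → InR T v u → q ≡ u ⊎ q ≺[ T ] u
  minimal u u∈R with InR⇒∈after s u∈R
  ... | here u≡q  = inj₁ (sym u≡q)
  ... | there u∈B = inj₂ (subst (λ xs → Precedes xs q u) (sym eq′) (∈⇒Precedes _ u∈B))
    where
    eq′ : positions T ≡ (A ++ v ∷ map (v ++_) (positionsF 0 cs)) ++ q ∷ B
    eq′ = trans eq (sym (++-assoc A (v ∷ map (v ++_) (positionsF 0 cs)) (q ∷ B)))

lemma1 : (T : Tree) (v : Pos) → Vertex T v → ¬ (v ≡ []) →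
    ((∃ λ u → InR T v u) → IsMinR T v (paStar T v))
    × ((¬ (∃ λ u → InR T v u)) → paStar T v ≡ [])
lemma1 T v v∈T _ with subtree-vertex T v∈T
... | cs , st with Split-paStarRev T (reverse v) v (sym (reverse-involutive v)) st
... | s , paStar≡ = subst (MinROrRoot T v) (sym paStar≡) (Split⇒MinROrRoot s)
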